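{- A graph $G$ contains a semi-perfect matching if and only if $G^{\odot}$ contains a perfect matching.
   Context: A graph has finite vertex and edge sets; every edge is a normal edge (two distinct end-vertices, adding 1 to each degree), a loop (one vertex, adding 2 to its degree) or a semi-edge (one vertex, adding 1 to its degree); multiple loops, semi-edges and parallel edges are allowed. A semi-perfect matching of $G$ is a set $M\subseteq E(G)$ such that the spanning subgraph $(V(G),M)$ is 1-regular (semi-edges contribute 1 to the degree, loops 2). A perfect matching is a set of normal edges such that every vertex is incident with exactly one of them. $G^{\odot}$ has vertex set $\{v_0,v_1: v\in V(G)\}$; each normal edge $e=uv$ of $G$ gives edges $e_0$ joining $u_0,v_0$ and $e_1$ joining $u_1,v_1$; each loop $e$ at $v$ gives a loop at $v_0$ and a loop at $v_1$; each semi-edge $e$ at $v$ gives one normal edge $\tilde e$ joining $v_0,v_1$ ($G^{\odot}$ has no semi-edges). -}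

module Defs where

open import Data.Nat using (ℕ; zero; suc; _+_)
open import Data.Fin using (Fin; _≟_; _↑ˡ_; _↑ʳ_; splitAt)
open import Data.Fin.Properties using (↑ˡ-injective; ↑ʳ-injective; splitAt-↑ˡ; splitAt-↑ʳ)
open import Data.Sum using (inj₁; inj₂)
open import Data.Bool using (Bool; true; false; if_then_else_)
open import Data.List using (List; []; _∷_; _++_; length; lookup; concatMap; allFin; map)
open import Data.Nat.ListAction using (sum)
open import Data.Product using (_×_)
open import Data.Unit using (⊤)
open import Data.Empty using (⊥)
open import Relation.Nullary using (¬_; does)
open import Relation.Binary.PropositionalEquality using (_≡_; cong; trans; sym)

data Edge (n : ℕ) : Set where
  normal : (u v : Fin n) → ¬ (u ≡ v) → Edge n
  loop   : Fin n → Edge n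
  semi   : Fin n → Edge n

-- A finite graph: vertex set Fin n, edge set = positions of the list 'edges'
-- (so multiple loops, semi-edges and parallel edges are allowed).
record Graph : Set where
  constructor mkGraph
  field
    n     : ℕ
    edges : List (Edge n)
open Graph public

EdgeIx : Graph → Set
EdgeIx G = Fin (length (edges G))

edgeAt : (G : Graph) → EdgeIx G → Edge (n G)
edgeAt G e = lookup (edges G) e

contrib : ∀ {k} → Edge k → Fin k → ℕ
contrib (normal u v _) x = (if does (x ≟ u) then 1 else 0) + (if does (x ≟ v) then 1 else 0)
contrib (loop u) x = if does (x ≟ u) then 2 else 0
contrib (semi u) x = if does (x ≟ u) then 1 else 0

degIn : (G : Graph) → (EdgeIx G → Bool) → Fin (n G) → ℕ
degIn G M x = sum (map (λ e → if M e then contrib (edgeAt G e) x else 0) (allFin (length (edges G))))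

IsSemiPerfectMatching : (G : Graph) → (EdgeIx G → Bool) → Set
IsSemiPerfectMatching G M = ∀ x → degIn G M x ≡ 1

IsNormal : ∀ {k} → Edge k → Set
IsNormal (normal _ _ _) = ⊤
IsNormal (loop _) = ⊥
IsNormal (semi _) = ⊥

IsPerfectMatching : (G : Graph) → (EdgeIx G → Bool) → Set
IsPerfectMatching G M =
  (∀ e → M e ≡ true → IsNormal (edgeAt G e)) × (∀ x → degIn G M x ≡ 1)

HasSemiPerfectMatching HasPerfectMatching : Graph → Set
HasSemiPerfectMatching G = Σ (EdgeIx G → Bool) (IsSemiPerfectMatching G)
  where open import Data.Product using (Σ)
HasPerfectMatching G = Σ (EdgeIx G → Bool) (IsPerfectMatching G)
  where open import Data.Product using (Σ)

-- G^⊙ : vertex v₀ is 'v ↑ˡ n', v₁ is 'n ↑ʳ v' in Fin (n + n)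
↑ˡ≢↑ʳ : ∀ {k} (u v : Fin k) → ¬ (u ↑ˡ k ≡ k ↑ʳ v)
↑ˡ≢↑ʳ {k} u v eq with trans (sym (splitAt-↑ˡ k u k)) (trans (cong (splitAt k) eq) (splitAt-↑ʳ k k v))
... | ()

doubleEdge : ∀ {k} → Edge k → List (Edge (k + k))
doubleEdge {k} (normal u v u≢v) =
  normal (u ↑ˡ k) (v ↑ˡ k) (λ eq → u≢v (↑ˡ-injective k u v eq)) ∷
  normal (k ↑ʳ u) (k ↑ʳ v) (λ eq → u≢v (↑ʳ-injective k u v eq)) ∷ []
doubleEdge {k} (loop v) = loop (v ↑ˡ k) ∷ loop (k ↑ʳ v) ∷ []
doubleEdge {k} (semi v) = normal (v ↑ˡ k) (k ↑ʳ v) (↑ˡ≢↑ʳ v v) ∷ []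

_⊙ : Graph → Graph
G ⊙ = mkGraph (n G + n G) (concatMap doubleEdge (edges G))

{-# OPTIONS --safe #-}
module Submission where

-- A semi-perfect matching M contains no loop, since a loop alone gives its vertex degree 2.
-- Taking every copy of every edge of M (e₀ and e₁ for a normal edge, ẽ for a semi-edge)
-- therefore gives a set of normal edges of G⊙ in which v₀ and v₁ both have the degree v has
-- in M. Conversely, a perfect matching of G⊙ contains no loop, so the edges e of G whose first
-- copy (e₀ or ẽ) it contains meet each v exactly as often as the matching meets v₀.

open import Defs
open import Function using (_∘_)
open import Function.Bundles using (_⇔_; mk⇔)
open import Data.Nat using (ℕ; _+_; _≤_)
open import Data.Nat.Properties using (+-identityʳ; <-irrefl; m≤m+n; m≤n+m; ≤-trans; module ≤-Reasoning)
open import Data.Fin using (Fin; zero; suc; _≟_; _↑ˡ_; _↑ʳ_; join; splitAt)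
open import Data.Fin.Properties using (↑ˡ-injective; ↑ʳ-injective; join-splitAt)
open import Data.Sum using ([_,_])
open import Data.Bool using (Bool; true; false; if_then_else_)
open import Data.Bool.Properties using (¬-not; if-eta)
open import Data.List using (List; []; _∷_; length; lookup; concatMap; tabulate)
open import Data.List.Properties using (map-tabulate)
open import Data.Nat.ListAction using (sum)
open import Data.Product using (_,_)
open import Data.Unit using (⊤; tt)
open import Data.Empty using (⊥)
open import Relation.Nullary using (¬_; does)
open import Relation.Nullary.Decidable using (does-⇔; dec-true; dec-false)
open import Relation.Binary.PropositionalEquality using (_≡_; refl; sym; trans; cong; cong₂; subst; module ≡-Reasoning)

degree : ∀ {m} (es : List (Edge m)) → (Fin (length es) → Bool) → Fin m → ℕ
degree []       M x = 0
degree (e ∷ es) M x = (if M zero then contrib e x else 0) + degree es (M ∘ suc) x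

degIn≡degree : (G : Graph) (M : EdgeIx G → Bool) (x : Fin (n G)) → degIn G M x ≡ degree (edges G) M x
degIn≡degree G M x =
  trans (cong sum (map-tabulate (λ i → i) (λ i → if M i then contrib (edgeAt G i) x else 0)))
        (sum-tabulate (edges G) M)
  where
    sum-tabulate : ∀ {m} (es : List (Edge m)) (M : Fin (length es) → Bool) {x : Fin m} →
                   sum (tabulate (λ i → if M i then contrib (lookup es i) x else 0)) ≡ degree es M x
    sum-tabulate []       M = refl
    sum-tabulate (e ∷ es) M = cong₂ _+_ refl (sum-tabulate es (M ∘ suc))

OnlyNormal : ∀ {m} (es : List (Edge m)) → (Fin (length es) → Bool) → Set
OnlyNormal es M = ∀ j → M j ≡ true → IsNormal (lookup es j)

IsLoop : ∀ {m} → Edge m → Set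
IsLoop (loop _) = ⊤
IsLoop _        = ⊥

contrib≤degree : ∀ {m} (es : List (Edge m)) (M : Fin (length es) → Bool) (i : Fin (length es)) →
                 M i ≡ true → ∀ x → contrib (lookup es i) x ≤ degree es M x
contrib≤degree (e ∷ es) M zero    sel x rewrite sel = m≤m+n _ _
contrib≤degree (e ∷ es) M (suc i) sel x = ≤-trans (contrib≤degree es (M ∘ suc) i sel x) (m≤n+m _ _)

contrib-loop-self : ∀ {m} (v : Fin m) → contrib (loop v) v ≡ 2
contrib-loop-self v rewrite dec-true (v ≟ v) refl = refl

selected-not-loop : ∀ {m} (es : List (Edge m)) (M : Fin (length es) → Bool) →
                    (∀ x → degree es M x ≡ 1) → ∀ i → M i ≡ true → ¬ IsLoop (lookup es i)
selected-not-loop es M regular i sel isLoop with lookup es i | contrib≤degree es M i sel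
... | loop v | contrib≤ = <-irrefl refl (begin
  2                  ≡⟨ sym (contrib-loop-self v) ⟩
  contrib (loop v) v ≤⟨ contrib≤ v ⟩
  degree es M v      ≡⟨ regular v ⟩
  1                  ∎)
  where open ≤-Reasoning

module _ {k : ℕ} where

  ↑ˡ≟↑ˡ : (x u : Fin k) → does (x ↑ˡ k ≟ u ↑ˡ k) ≡ does (x ≟ u)
  ↑ˡ≟↑ˡ x u = does-⇔ (mk⇔ (↑ˡ-injective k x u) (cong (_↑ˡ k))) (x ↑ˡ k ≟ u ↑ˡ k) (x ≟ u)

  ↑ʳ≟↑ʳ : (x u : Fin k) → does (k ↑ʳ x ≟ k ↑ʳ u) ≡ does (x ≟ u)
  ↑ʳ≟↑ʳ x u = does-⇔ (mk⇔ (↑ʳ-injective k x u) (cong (k ↑ʳ_))) (k ↑ʳ x ≟ k ↑ʳ u) (x ≟ u)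

  ↑ˡ≟↑ʳ : (x u : Fin k) → does (x ↑ˡ k ≟ k ↑ʳ u) ≡ false
  ↑ˡ≟↑ʳ x u = dec-false (x ↑ˡ k ≟ k ↑ʳ u) (↑ˡ≢↑ʳ x u)

  ↑ʳ≟↑ˡ : (x u : Fin k) → does (k ↑ʳ x ≟ u ↑ˡ k) ≡ false
  ↑ʳ≟↑ˡ x u = dec-false (k ↑ʳ x ≟ u ↑ˡ k) (↑ˡ≢↑ʳ u x ∘ sym)

  ↑-elim : {P : Fin (k + k) → Set} → (∀ x → P (x ↑ˡ k)) → (∀ x → P (k ↑ʳ x)) → ∀ y → P y
  ↑-elim {P} Pˡ Pʳ y = subst P (join-splitAt k k y) ([_,_] {C = P ∘ join k k} Pˡ Pʳ (splitAt k y))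

  doubleEdges : List (Edge k) → List (Edge (k + k))
  doubleEdges = concatMap doubleEdge

  origin : (es : List (Edge k)) → Fin (length (doubleEdges es)) → Fin (length es)
  origin (normal _ _ _ ∷ es) zero          = zero
  origin (normal _ _ _ ∷ es) (suc zero)    = zero
  origin (normal _ _ _ ∷ es) (suc (suc j)) = suc (origin es j)
  origin (loop _ ∷ es)       zero          = zero
  origin (loop _ ∷ es)       (suc zero)    = zero
  origin (loop _ ∷ es)       (suc (suc j)) = suc (origin es j)
  origin (semi _ ∷ es)       zero          = zero
  origin (semi _ ∷ es)       (suc j)       = suc (origin es j)

  firstCopy : (es : List (Edge k)) → Fin (length es) → Fin (length (doubleEdges es))
  firstCopy (normal _ _ _ ∷ es) zero    = zero
  firstCopy (normal _ _ _ ∷ es) (suc i) = suc (suc (firstCopy es i))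
  firstCopy (loop _ ∷ es)       zero    = zero
  firstCopy (loop _ ∷ es)       (suc i) = suc (suc (firstCopy es i))
  firstCopy (semi _ ∷ es)       zero    = zero
  firstCopy (semi _ ∷ es)       (suc i) = suc (firstCopy es i)

  non-loop-copy-normal : (es : List (Edge k)) (j : Fin (length (doubleEdges es))) →
                         ¬ IsLoop (lookup es (origin es j)) → IsNormal (lookup (doubleEdges es) j)
  non-loop-copy-normal (normal _ _ _ ∷ es) zero          _ = tt
  non-loop-copy-normal (normal _ _ _ ∷ es) (suc zero)    _ = tt
  non-loop-copy-normal (normal _ _ _ ∷ es) (suc (suc j)) h = non-loop-copy-normal es j h
  non-loop-copy-normal (loop _ ∷ es)       zero          h = h tt
  non-loop-copy-normal (loop _ ∷ es)       (suc zero)    h = h tt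
  non-loop-copy-normal (loop _ ∷ es)       (suc (suc j)) h = non-loop-copy-normal es j h
  non-loop-copy-normal (semi _ ∷ es)       zero          _ = tt
  non-loop-copy-normal (semi _ ∷ es)       (suc j)       h = non-loop-copy-normal es j h

  degree-origin-↑ˡ : (es : List (Edge k)) (M : Fin (length es) → Bool) (x : Fin k) →
                     degree (doubleEdges es) (M ∘ origin es) (x ↑ˡ k) ≡ degree es M x
  degree-origin-↑ˡ [] M x = refl
  degree-origin-↑ˡ (normal u v _ ∷ es) M x
    rewrite ↑ˡ≟↑ˡ x u | ↑ˡ≟↑ˡ x v | ↑ˡ≟↑ʳ x u | ↑ˡ≟↑ʳ x v | if-eta (M zero) {0}
    = cong₂ _+_ refl (degree-origin-↑ˡ es (M ∘ suc) x)
  degree-origin-↑ˡ (loop v ∷ es) M x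
    rewrite ↑ˡ≟↑ˡ x v | ↑ˡ≟↑ʳ x v | if-eta (M zero) {0}
    = cong₂ _+_ refl (degree-origin-↑ˡ es (M ∘ suc) x)
  degree-origin-↑ˡ (semi v ∷ es) M x
    rewrite ↑ˡ≟↑ˡ x v | ↑ˡ≟↑ʳ x v | +-identityʳ (if does (x ≟ v) then 1 else 0)
    = cong₂ _+_ refl (degree-origin-↑ˡ es (M ∘ suc) x)

  degree-origin-↑ʳ : (es : List (Edge k)) (M : Fin (length es) → Bool) (x : Fin k) →
                     degree (doubleEdges es) (M ∘ origin es) (k ↑ʳ x) ≡ degree es M x
  degree-origin-↑ʳ [] M x = refl
  degree-origin-↑ʳ (normal u v _ ∷ es) M x
    rewrite ↑ʳ≟↑ʳ x u | ↑ʳ≟↑ʳ x v | ↑ʳ≟↑ˡ x u | ↑ʳ≟↑ˡ x v | if-eta (M zero) {0}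
    = cong₂ _+_ refl (degree-origin-↑ʳ es (M ∘ suc) x)
  degree-origin-↑ʳ (loop v ∷ es) M x
    rewrite ↑ʳ≟↑ʳ x v | ↑ʳ≟↑ˡ x v | if-eta (M zero) {0}
    = cong₂ _+_ refl (degree-origin-↑ʳ es (M ∘ suc) x)
  degree-origin-↑ʳ (semi v ∷ es) M x
    rewrite ↑ʳ≟↑ʳ x v | ↑ʳ≟↑ˡ x v
    = cong₂ _+_ refl (degree-origin-↑ʳ es (M ∘ suc) x)

  degree-firstCopy : (es : List (Edge k)) (M : Fin (length (doubleEdges es)) → Bool) →
                     OnlyNormal (doubleEdges es) M → (x : Fin k) →
                     degree es (M ∘ firstCopy es) x ≡ degree (doubleEdges es) M (x ↑ˡ k)
  degree-firstCopy [] M onlyNormal x = refl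
  degree-firstCopy (normal u v _ ∷ es) M onlyNormal x
    rewrite ↑ˡ≟↑ˡ x u | ↑ˡ≟↑ˡ x v | ↑ˡ≟↑ʳ x u | ↑ˡ≟↑ʳ x v | if-eta (M (suc zero)) {0}
    = cong₂ _+_ refl (degree-firstCopy es (M ∘ suc ∘ suc) (onlyNormal ∘ suc ∘ suc) x)
  degree-firstCopy (loop v ∷ es) M onlyNormal x
    rewrite ¬-not (onlyNormal zero) | ¬-not (onlyNormal (suc zero))
    = degree-firstCopy es (M ∘ suc ∘ suc) (onlyNormal ∘ suc ∘ suc) x
  degree-firstCopy (semi v ∷ es) M onlyNormal x
    rewrite ↑ˡ≟↑ˡ x v | ↑ˡ≟↑ʳ x v | +-identityʳ (if does (x ≟ v) then 1 else 0)
    = cong₂ _+_ refl (degree-firstCopy es (M ∘ suc) (onlyNormal ∘ suc) x)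

  semiPerfect⇒perfect⊙ : (es : List (Edge k)) (M : Fin (length es) → Bool) →
                         IsSemiPerfectMatching (mkGraph k es) M →
                         IsPerfectMatching (mkGraph k es ⊙) (M ∘ origin es)
  semiPerfect⇒perfect⊙ es M semiPerfect = onlyNormal , ↑-elim perfectˡ perfectʳ
    where
      G = mkGraph k es
      regular : ∀ x → degree es M x ≡ 1
      regular x = trans (sym (degIn≡degree G M x)) (semiPerfect x)
      onlyNormal : OnlyNormal (doubleEdges es) (M ∘ origin es)
      onlyNormal j sel = non-loop-copy-normal es j (selected-not-loop es M regular (origin es j) sel)
      perfectˡ : ∀ x → degIn (G ⊙) (M ∘ origin es) (x ↑ˡ k) ≡ 1
      perfectˡ x = trans (degIn≡degree (G ⊙) _ (x ↑ˡ k)) (trans (degree-origin-↑ˡ es M x) (regular x))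
      perfectʳ : ∀ x → degIn (G ⊙) (M ∘ origin es) (k ↑ʳ x) ≡ 1
      perfectʳ x = trans (degIn≡degree (G ⊙) _ (k ↑ʳ x)) (trans (degree-origin-↑ʳ es M x) (regular x))

  perfect⊙⇒semiPerfect : (es : List (Edge k)) (M : Fin (length (doubleEdges es)) → Bool) →
                         IsPerfectMatching (mkGraph k es ⊙) M →
                         IsSemiPerfectMatching (mkGraph k es) (M ∘ firstCopy es)
  perfect⊙⇒semiPerfect es M (onlyNormal , perfect) x = begin
    degIn G (M ∘ firstCopy es) x        ≡⟨ degIn≡degree G _ x ⟩
    degree es (M ∘ firstCopy es) x      ≡⟨ degree-firstCopy es M onlyNormal x ⟩
    degree (doubleEdges es) M (x ↑ˡ k)  ≡⟨ degIn≡degree (G ⊙) M (x ↑ˡ k) ⟨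
    degIn (G ⊙) M (x ↑ˡ k)              ≡⟨ perfect (x ↑ˡ k) ⟩
    1                                   ∎
    where
      G = mkGraph k es
      open ≡-Reasoning

proposition11 : (G : Graph) → HasSemiPerfectMatching G ⇔ HasPerfectMatching (G ⊙)
proposition11 (mkGraph k es) = mk⇔
  (λ (M , semiPerfect) → M ∘ origin es , semiPerfect⇒perfect⊙ es M semiPerfect)
  (λ (M , perfect) → M ∘ firstCopy es , perfect⊙⇒semiPerfect es M perfect)
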